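{- Let $\mathcal{F}$ be a $k$-uniform odd-sunflower-free antichain on an $n$-element underlying set. Then for every positive integer $m$, $f_{oa}(nm)\ge |\mathcal{F}|\,(f_{oa}(m))^k$. In particular, for odd $n$, $f_{oa}(nm)\ge n\,(f_{oa}(m))^{n-1}$.
   Context: A family of at least two nonempty sets is an odd-sunflower if every element of the underlying set is contained in an odd number of its sets, or in none; a family is odd-sunflower-free if none of its subfamilies is an odd-sunflower. A family is an antichain if no member is a proper subset of another; it is $k$-uniform if all members have exactly $k$ elements. $f_{oa}(n)$ denotes the maximum size of an odd-sunflower-free antichain of subsets of $\{1,\dots,n\}$. -}

module Defs where

open import Data.Nat using (ℕ; zero; suc; _≤_; _%_)
open import Data.Fin using (Fin)
open import Data.Fin.Subset using (Subset; _∈_; _⊂_; ∣_∣; Nonempty)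
open import Data.Fin.Subset.Properties using (_∈?_)
open import Data.List using (List; length; filter)
open import Data.List.Relation.Unary.All using (All)
open import Data.List.Relation.Unary.Unique.Propositional using (Unique)
open import Data.List.Membership.Propositional using () renaming (_∈_ to _∈ᴸ_)
open import Data.List.Relation.Binary.Sublist.Propositional using () renaming (_⊆_ to _⊑_)
open import Data.Sum using (_⊎_)
open import Data.Product using (_×_; Σ)
open import Relation.Binary.PropositionalEquality using (_≡_)
open import Relation.Nullary using (¬_)

-- A family of subsets of {0,…,n-1}: a list of subsets; being a *set* of sets
-- is imposed by requiring the list to have no repeated members (Unique).
Family : ℕ → Set
Family n = List (Subset n)

count : ∀ {n} → Fin n → Family n → ℕ
count x 𝒢 = length (filter (λ A → x ∈? A) 𝒢)

OddSunflower : ∀ {n} → Family n → Set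
OddSunflower {n} 𝒢 =
  (2 ≤ length 𝒢) × All Nonempty 𝒢 ×
  ((x : Fin n) → (count x 𝒢 % 2 ≡ 1) ⊎ (count x 𝒢 ≡ 0))

OddSunflowerFree : ∀ {n} → Family n → Set
OddSunflowerFree 𝒜 = ∀ 𝒢 → 𝒢 ⊑ 𝒜 → ¬ OddSunflower 𝒢

Antichain : ∀ {n} → Family n → Set
Antichain 𝒜 = ∀ {A B} → A ∈ᴸ 𝒜 → B ∈ᴸ 𝒜 → ¬ (A ⊂ B)

Uniform : ∀ {n} → ℕ → Family n → Set
Uniform k 𝒜 = All (λ A → ∣ A ∣ ≡ k) 𝒜

OSFAntichain : ∀ {n} → Family n → Set
OSFAntichain 𝒜 = Unique 𝒜 × OddSunflowerFree 𝒜 × Antichain 𝒜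

-- IsFoa n v  :  v = f_oa(n), the maximum size of an odd-sunflower-free
-- antichain of subsets of an n-element set (attained, and an upper bound).
IsFoa : ℕ → ℕ → Set
IsFoa n v =
  Σ (Family n) (λ 𝒜 → OSFAntichain 𝒜 × length 𝒜 ≡ v) ×
  (∀ (𝒜 : Family n) → OSFAntichain 𝒜 → length 𝒜 ≤ v)

-- Let 𝒜 be an extremal family on [m] (w.l.o.g. of nonempty sets) and replace every point i of every
-- F ∈ 𝓕 by a member Aᵢ of 𝒜; this gives |𝓕|·|𝒜|^k distinct sets on [n] × [m], forming an antichain.
-- Suppose G is an odd sunflower among them. For each i, the i-th blocks of the members of G form a
-- multiset over 𝒜 ∪ {∅} in which every point has odd or zero multiplicity. Keeping the members of 𝒜
-- of odd multiplicity gives a subfamily of 𝒜 with the same parities, hence with at most one member,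
-- so all nonempty i-th blocks coincide. Then the supports {i : Aᵢ ≠ ∅} of the members of G are
-- distinct and form an odd sunflower in 𝓕, which is impossible. For odd n, the n complements of
-- singletons form an (n−1)-uniform odd-sunflower-free antichain.

module Submission where

open import Defs
open import Data.Nat using (ℕ; _≤_; _*_; _^_; _∸_; _%_)
open import Data.List using (length)
open import Data.Product using (_×_)
open import Relation.Binary.PropositionalEquality using (_≡_)

open import Data.Bool using (Bool; true; false; not; _∧_; _xor_; T?)
import Data.Bool as Bool
open import Data.Bool.Properties using (not-involutive)
import Data.Empty
open import Data.Empty using (⊥-elim)
open import Data.Fin using (Fin; zero; suc; combine)
import Data.Fin.Properties as Fin
open import Data.Fin.Properties using (combine-surjective; all?; ¬∀⟶∃¬)
open import Data.Fin.Subset using (Subset; _∈_; _∉_; _⊆_; _⊂_; ⊥; ⁅_⁆; ∁; Nonempty; ∣_∣)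
open import Data.Fin.Subset.Properties
  using (_∈?_; ∉⊥; ⊥⊆; ⊆-antisym; nonempty?; Empty-unique; x∈⁅x⁆; x≢y⇒x∉⁅y⁆; x∈∁p⇒x∉p; x∉p⇒x∈∁p; ∣∁p∣≡n∸∣p∣; ∣⁅x⁆∣≡1)
open import Data.List using (List; []; _∷_; [_]; map; allFin; filter; filterᵇ; concatMap; cartesianProductWith)
open import Data.List.Properties using (length-filter; length-map; length-++; length-tabulate)
open import Data.List.Membership.Propositional using (find; lose) renaming (_∈_ to _∈ᴸ_)
open import Data.List.Membership.Propositional.Properties
  using (∈-filter⁻; ∈-map⁺; ∈-map⁻; ∈-concatMap⁻; ∈-cartesianProductWith⁻)
open import Data.List.Relation.Binary.Sublist.Propositional using ([]; _∷_; _∷ʳ_) renaming (_⊆_ to _⊑_)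
import Data.List.Relation.Binary.Sublist.Propositional as Sublist
import Data.List.Relation.Binary.Sublist.Heterogeneous.Properties as Sublist
open import Data.List.Relation.Binary.Sublist.Propositional.Properties using (filter-⊆; All-resp-⊆)
open import Data.List.Relation.Unary.All using (All; []; _∷_)
import Data.List.Relation.Unary.All as All
import Data.List.Relation.Unary.All.Properties as All
open import Data.List.Relation.Unary.AllPairs using ([]; _∷_)
import Data.List.Relation.Unary.AllPairs as AllPairs
import Data.List.Relation.Unary.AllPairs.Properties as AllPairs
open import Data.List.Relation.Unary.Any using (here; there; any?)
open import Data.List.Relation.Unary.Unique.Propositional using (Unique)
import Data.List.Relation.Unary.Unique.Propositional.Properties as Unique
open import Data.Nat using (zero; suc; _+_; z≤n; s≤s; _≤?_)
open import Data.Nat.Properties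
open import Algebra.Properties.CommutativeSemigroup +-commutativeSemigroup using (interchange)
open import Data.Product using (_,_; proj₁; proj₂; Σ)
open import Data.Sum using (_⊎_; inj₁; inj₂)
open import Data.Vec using (Vec; lookup; tabulate; concat; []; _∷_)
open import Data.Vec.Properties
  using (lookup⇒[]=; ≡-dec; lookup∘tabulate; tabulate∘lookup; tabulate-cong; lookup-concat; ∷-injective; ∷-injectiveʳ)
open import Function using (_∘_)
open import Level using (0ℓ)
open import Relation.Binary using (DecidableEquality)
open import Relation.Binary.PropositionalEquality using (refl; sym; trans; cong; cong₂; subst; _≢_; module ≡-Reasoning)
open import Relation.Nullary using (Dec; yes; no; does; ¬_)
open import Relation.Nullary.Decidable using (dec-true; dec-false)
open import Relation.Unary using (Pred; Decidable)

toℕ : Bool → ℕ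
toℕ true = 1
toℕ false = 0

module _ {A : Set} where

  sumOf : (A → ℕ) → List A → ℕ
  sumOf f [] = 0
  sumOf f (x ∷ xs) = f x + sumOf f xs

  countᵇ : (A → Bool) → List A → ℕ
  countᵇ p = sumOf (λ x → toℕ (p x))

  sumOf-cong : ∀ {f g : A → ℕ} xs → (∀ {x} → x ∈ᴸ xs → f x ≡ g x) → sumOf f xs ≡ sumOf g xs
  sumOf-cong [] e = refl
  sumOf-cong (x ∷ xs) e = cong₂ _+_ (e (here refl)) (sumOf-cong xs (e ∘ there))

  sumOf-+ : ∀ (f g : A → ℕ) xs → sumOf (λ x → f x + g x) xs ≡ sumOf f xs + sumOf g xs
  sumOf-+ f g [] = refl
  sumOf-+ f g (x ∷ xs) rewrite sumOf-+ f g xs = interchange (f x) (g x) (sumOf f xs) (sumOf g xs)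

  sumOf-zero : ∀ {f : A → ℕ} xs → (∀ {x} → x ∈ᴸ xs → f x ≡ 0) → sumOf f xs ≡ 0
  sumOf-zero xs e = trans (sumOf-cong xs e) (zeros xs)
    where
    zeros : ∀ xs → sumOf (λ _ → 0) xs ≡ 0
    zeros [] = refl
    zeros (_ ∷ xs) = zeros xs

  ∈⇒≤sumOf : ∀ (f : A → ℕ) {xs x} → x ∈ᴸ xs → f x ≤ sumOf f xs
  ∈⇒≤sumOf f {y ∷ _} (here refl) = m≤m+n (f y) _
  ∈⇒≤sumOf f {y ∷ _} (there x∈) = ≤-trans (∈⇒≤sumOf f x∈) (m≤n+m _ (f y))

  sumOf-delta : ∀ {f : A → ℕ} {xs x} → Unique xs → x ∈ᴸ xs → (∀ y → y ≢ x → f y ≡ 0) → sumOf f xs ≡ f x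
  sumOf-delta {f} {x ∷ xs} (x∉ ∷ _) (here refl) off =
    trans (cong (f x +_) (sumOf-zero xs (λ y∈ → off _ (λ { refl → All.lookup x∉ y∈ refl })))) (+-identityʳ (f x))
  sumOf-delta {f} {y ∷ xs} (y∉ ∷ u) (there x∈) off =
    cong₂ _+_ (off y (λ { refl → All.lookup y∉ x∈ refl })) (sumOf-delta u x∈ off)

  length≡countᵇ : ∀ xs → length xs ≡ countᵇ (λ _ → true) xs
  length≡countᵇ [] = refl
  length≡countᵇ (x ∷ xs) = cong suc (length≡countᵇ xs)

  countᵇ-filter : ∀ (q : A → Bool) {P : Pred A 0ℓ} (P? : Decidable P) xs →
    countᵇ q (filter P? xs) ≡ sumOf (λ x → toℕ (q x) * toℕ (does (P? x))) xs
  countᵇ-filter q P? [] = refl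
  countᵇ-filter q P? (x ∷ xs) with does (P? x)
  ... | true = cong₂ _+_ (sym (*-identityʳ (toℕ (q x)))) (countᵇ-filter q P? xs)
  ... | false = trans (countᵇ-filter q P? xs)
                  (cong (_+ sumOf (λ x → toℕ (q x) * toℕ (does (P? x))) xs) (sym (*-zeroʳ (toℕ (q x)))))

  length-filter≡countᵇ : ∀ {P : Pred A 0ℓ} (P? : Decidable P) xs → length (filter P? xs) ≡ countᵇ (does ∘ P?) xs
  length-filter≡countᵇ P? xs = trans (length≡countᵇ (filter P? xs))
    (trans (countᵇ-filter (λ _ → true) P? xs) (sumOf-cong xs (λ {x} _ → *-identityˡ (toℕ (does (P? x))))))

countᵇ-map : ∀ {A B : Set} (q : B → Bool) (f : A → B) xs → countᵇ q (map f xs) ≡ countᵇ (q ∘ f) xs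
countᵇ-map q f [] = refl
countᵇ-map q f (x ∷ xs) = cong (toℕ (q (f x)) +_) (countᵇ-map q f xs)

Unique-resp-⊑ : ∀ {A : Set} {xs ys : List A} → xs ⊑ ys → Unique ys → Unique xs
Unique-resp-⊑ [] [] = []
Unique-resp-⊑ (_ ∷ʳ xs⊑) (_ ∷ u) = Unique-resp-⊑ xs⊑ u
Unique-resp-⊑ (refl ∷ xs⊑) (x∉ ∷ u) = All-resp-⊆ xs⊑ x∉ ∷ Unique-resp-⊑ xs⊑ u

map⁺-injectiveOn : ∀ {A B : Set} {f : A → B} {xs} → (∀ {x y} → x ∈ᴸ xs → y ∈ᴸ xs → f x ≡ f y → x ≡ y) →
  Unique xs → Unique (map f xs)
map⁺-injectiveOn {xs = []} inj [] = []
map⁺-injectiveOn {xs = x ∷ xs} inj (x∉ ∷ u) =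
  All.map⁺ (All.tabulate (λ {y} y∈ fx≡fy → All.lookup x∉ y∈ (inj (here refl) (there y∈) fx≡fy)))
  ∷ map⁺-injectiveOn (λ x∈ y∈ → inj (there x∈) (there y∈)) u

module Multiplicity {A : Set} (_≟_ : DecidableEquality A) where

  open import Data.List.Membership.DecPropositional _≟_ public using () renaming (_∈?_ to _∈ᴸ?_)

  mult : A → List A → ℕ
  mult x = countᵇ (λ y → does (x ≟ y))

  mult-unique : ∀ x {ys} → Unique ys → mult x ys ≡ toℕ (does (x ∈ᴸ? ys))
  mult-unique x {ys} u with x ∈ᴸ? ys
  ... | yes x∈ = trans (sumOf-delta u x∈ (λ y y≢x → cong toℕ (dec-false (x ≟ y) (y≢x ∘ sym))))
                       (cong toℕ (dec-true (x ≟ x) refl))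
  ... | no x∉ = sumOf-zero ys (λ {y} y∈ → cong toℕ (dec-false (x ≟ y) (λ { refl → x∉ y∈ })))

  countᵇ≡sumOf-mult : ∀ (q : A → Bool) {𝒜} → Unique 𝒜 → ∀ K → All (λ X → q X ≡ true → X ∈ᴸ 𝒜) K →
    countᵇ q K ≡ sumOf (λ A → toℕ (q A) * mult A K) 𝒜
  countᵇ≡sumOf-mult q {𝒜} u [] [] = sym (sumOf-zero 𝒜 (λ {A} _ → *-zeroʳ (toℕ (q A))))
  countᵇ≡sumOf-mult q {𝒜} u (X ∷ K) (X∈ ∷ K∈) = begin
      toℕ (q X) + countᵇ q K
    ≡⟨ cong₂ _+_ (sym (head-term (q X) refl)) (countᵇ≡sumOf-mult q u K K∈) ⟩
      sumOf (λ A → toℕ (q A) * toℕ (does (A ≟ X))) 𝒜 + sumOf (λ A → toℕ (q A) * mult A K) 𝒜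
    ≡⟨ sym (sumOf-+ _ _ 𝒜) ⟩
      sumOf (λ A → toℕ (q A) * toℕ (does (A ≟ X)) + toℕ (q A) * mult A K) 𝒜
    ≡⟨ sumOf-cong 𝒜 (λ {A} _ → sym (*-distribˡ-+ (toℕ (q A)) (toℕ (does (A ≟ X))) (mult A K))) ⟩
      sumOf (λ A → toℕ (q A) * mult A (X ∷ K)) 𝒜
    ∎
    where
    open ≡-Reasoning
    off : ∀ A → A ≢ X → toℕ (q A) * toℕ (does (A ≟ X)) ≡ 0
    off A A≢X rewrite dec-false (A ≟ X) A≢X = *-zeroʳ (toℕ (q A))
    head-term : ∀ b → q X ≡ b → sumOf (λ A → toℕ (q A) * toℕ (does (A ≟ X))) 𝒜 ≡ toℕ b
    head-term true qX = trans (sumOf-delta u (X∈ qX) off)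
                              (cong₂ (λ b c → toℕ b * toℕ c) qX (dec-true (X ≟ X) refl))
    head-term false qX = sumOf-zero 𝒜 (λ {A} _ → vanishes (A ≟ X))
      where
      vanishes : ∀ {A} → Dec (A ≡ X) → toℕ (q A) * toℕ (does (A ≟ X)) ≡ 0
      vanishes {A} (yes refl) = cong (λ b → toℕ b * toℕ (does (A ≟ X))) qX
      vanishes {A} (no A≢X) = off A A≢X

  restrictTo : List A → List A → List A
  restrictTo 𝒢 = filter (_∈ᴸ? 𝒢)

  ∈-restrictTo⁻ : ∀ 𝒢 {𝒜 X} → X ∈ᴸ restrictTo 𝒢 𝒜 → X ∈ᴸ 𝒢
  ∈-restrictTo⁻ 𝒢 {𝒜} = proj₂ ∘ ∈-filter⁻ (_∈ᴸ? 𝒢) {xs = 𝒜}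

  countᵇ-restrictTo : ∀ (q : A → Bool) {𝒜 𝒢} → Unique 𝒜 → Unique 𝒢 → All (_∈ᴸ 𝒜) 𝒢 →
    countᵇ q (restrictTo 𝒢 𝒜) ≡ countᵇ q 𝒢
  countᵇ-restrictTo q {𝒜} {𝒢} u𝒜 u𝒢 𝒢⊆𝒜 = begin
      countᵇ q (restrictTo 𝒢 𝒜)
    ≡⟨ countᵇ-filter q (_∈ᴸ? 𝒢) 𝒜 ⟩
      sumOf (λ A → toℕ (q A) * toℕ (does (A ∈ᴸ? 𝒢))) 𝒜
    ≡⟨ sumOf-cong 𝒜 (λ {A} _ → cong (toℕ (q A) *_) (sym (mult-unique A u𝒢))) ⟩
      sumOf (λ A → toℕ (q A) * mult A 𝒢) 𝒜
    ≡⟨ sym (countᵇ≡sumOf-mult q u𝒜 𝒢 (All.map (λ A∈ _ → A∈) 𝒢⊆𝒜)) ⟩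
      countᵇ q 𝒢
    ∎
    where open ≡-Reasoning

  unique-⊆⇒length-≤ : ∀ {𝒜 𝒢} → Unique 𝒜 → Unique 𝒢 → All (_∈ᴸ 𝒜) 𝒢 → length 𝒢 ≤ length 𝒜
  unique-⊆⇒length-≤ {𝒜} {𝒢} u𝒜 u𝒢 𝒢⊆𝒜 = begin
    length 𝒢                     ≡⟨ length≡countᵇ 𝒢 ⟩
    countᵇ _ 𝒢                   ≡⟨ countᵇ-restrictTo _ u𝒜 u𝒢 𝒢⊆𝒜 ⟨
    countᵇ _ (restrictTo 𝒢 𝒜)    ≡⟨ length≡countᵇ (restrictTo 𝒢 𝒜) ⟨
    length (restrictTo 𝒢 𝒜)      ≤⟨ length-filter _ 𝒜 ⟩
    length 𝒜                     ∎
    where open ≤-Reasoning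

odd : ℕ → Bool
odd zero = false
odd (suc n) = not (odd n)

odd-+ : ∀ m n → odd (m + n) ≡ odd m xor odd n
odd-+ zero n = refl
odd-+ (suc m) n rewrite odd-+ m n with odd m
... | true = not-involutive (odd n)
... | false = refl

odd-toℕ : ∀ b → odd (toℕ b) ≡ b
odd-toℕ true = refl
odd-toℕ false = refl

odd-toℕ* : ∀ b n → odd (toℕ b * n) ≡ b ∧ odd n
odd-toℕ* true n = cong odd (+-identityʳ n)
odd-toℕ* false n = refl

odd-sumOf-cong : ∀ {A : Set} {f g : A → ℕ} → (∀ x → odd (f x) ≡ odd (g x)) → ∀ xs → odd (sumOf f xs) ≡ odd (sumOf g xs)
odd-sumOf-cong e [] = refl
odd-sumOf-cong {f = f} {g} e (x ∷ xs) = begin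
  odd (f x + sumOf f xs)           ≡⟨ odd-+ (f x) _ ⟩
  odd (f x) xor odd (sumOf f xs)   ≡⟨ cong₂ _xor_ (e x) (odd-sumOf-cong e xs) ⟩
  odd (g x) xor odd (sumOf g xs)   ≡⟨ odd-+ (g x) _ ⟨
  odd (g x + sumOf g xs)           ∎
  where open ≡-Reasoning

odd⇒%2≡1 : ∀ n → odd n ≡ true → n % 2 ≡ 1
odd⇒%2≡1 (suc zero) _ = refl
odd⇒%2≡1 (suc (suc n)) e = odd⇒%2≡1 n (trans (sym (not-involutive (odd n))) e)

%2≡1⇒odd : ∀ n → n % 2 ≡ 1 → odd n ≡ true
%2≡1⇒odd (suc zero) _ = refl
%2≡1⇒odd (suc (suc n)) e = trans (not-involutive (odd n)) (%2≡1⇒odd n e)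

OddOrZero : ℕ → Set
OddOrZero c = c % 2 ≡ 1 ⊎ c ≡ 0

OddOrZero⇒odd⊎zero : ∀ {c} → OddOrZero c → odd c ≡ true ⊎ c ≡ 0
OddOrZero⇒odd⊎zero {c} (inj₁ c-odd) = inj₁ (%2≡1⇒odd c c-odd)
OddOrZero⇒odd⊎zero (inj₂ c≡0) = inj₂ c≡0

_∈ᵇ_ : ∀ {n} → Fin n → Subset n → Bool
x ∈ᵇ A = lookup A x

∈ᵇ≡does-∈? : ∀ {n} (x : Fin n) A → x ∈ᵇ A ≡ does (x ∈? A)
∈ᵇ≡does-∈? zero (true ∷ _) = refl
∈ᵇ≡does-∈? zero (false ∷ _) = refl
∈ᵇ≡does-∈? (suc x) (_ ∷ A) = ∈ᵇ≡does-∈? x A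

module _ {n : ℕ} where

  _≟ˢ_ : DecidableEquality (Subset n)
  _≟ˢ_ = ≡-dec Bool._≟_

  ∈⇒∈ᵇ : ∀ {x : Fin n} {A} → x ∈ A → x ∈ᵇ A ≡ true
  ∈⇒∈ᵇ {x} {A} x∈ = trans (∈ᵇ≡does-∈? x A) (dec-true (x ∈? A) x∈)

  ∉⇒∈ᵇ : ∀ {x : Fin n} {A} → ¬ x ∈ A → x ∈ᵇ A ≡ false
  ∉⇒∈ᵇ {x} {A} x∉ = trans (∈ᵇ≡does-∈? x A) (dec-false (x ∈? A) x∉)

  ∈ᵇ⇒∈ : ∀ {x : Fin n} {A} → x ∈ᵇ A ≡ true → x ∈ A
  ∈ᵇ⇒∈ {x} {A} = lookup⇒[]= x A

  x∈ᵇ⊥ : ∀ (x : Fin n) → x ∈ᵇ ⊥ ≡ false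
  x∈ᵇ⊥ x = ∉⇒∈ᵇ ∉⊥

  ¬Nonempty⊥ : ¬ Nonempty (⊥ {n})
  ¬Nonempty⊥ (_ , x∈⊥) = ∉⊥ x∈⊥

  count≡countᵇ : ∀ x (𝒢 : Family n) → count x 𝒢 ≡ countᵇ (x ∈ᵇ_) 𝒢
  count≡countᵇ x 𝒢 =
    trans (length-filter≡countᵇ (x ∈?_) 𝒢) (sumOf-cong 𝒢 (λ {A} _ → cong toℕ (sym (∈ᵇ≡does-∈? x A))))

  ⊆∧⊄⇒≡ : ∀ {X Y : Subset n} → X ⊆ Y → ¬ (X ⊂ Y) → X ≡ Y
  ⊆∧⊄⇒≡ {X} {Y} X⊆Y X⊄Y = ⊆-antisym X⊆Y Y⊆X
    where
    Y⊆X : Y ⊆ X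
    Y⊆X {x} x∈Y with x ∈? X
    ... | yes x∈X = x∈X
    ... | no x∉X = ⊥-elim (X⊄Y (X⊆Y , x , x∈Y , x∉X))

  subfamily-¬OddSunflower : ∀ {𝓕 𝒢 : Family n} → Unique 𝓕 → OddSunflowerFree 𝓕 →
    Unique 𝒢 → All (_∈ᴸ 𝓕) 𝒢 → ¬ OddSunflower 𝒢
  subfamily-¬OddSunflower {𝓕} {𝒢} u𝓕 osf u𝒢 𝒢⊆𝓕 (two , ne , oddOrZero) =
    osf 𝒢′ (filter-⊆ (_∈ᴸ? 𝒢) 𝓕) (two′ , ne′ , oddOrZero′)
    where
    open Multiplicity _≟ˢ_
    𝒢′ : Family n
    𝒢′ = restrictTo 𝒢 𝓕
    same-count : ∀ q → countᵇ q 𝒢′ ≡ countᵇ q 𝒢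
    same-count q = countᵇ-restrictTo q {𝓕} {𝒢} u𝓕 u𝒢 𝒢⊆𝓕
    two′ : 2 ≤ length 𝒢′
    two′ = ≤-trans two (≤-reflexive (begin
      length 𝒢                 ≡⟨ length≡countᵇ 𝒢 ⟩
      countᵇ (λ _ → true) 𝒢    ≡⟨ same-count _ ⟨
      countᵇ (λ _ → true) 𝒢′   ≡⟨ length≡countᵇ 𝒢′ ⟨
      length 𝒢′                ∎))
      where open ≡-Reasoning
    ne′ : All Nonempty 𝒢′
    ne′ = All.tabulate (All.lookup ne ∘ ∈-restrictTo⁻ 𝒢 {𝓕})
    oddOrZero′ : ∀ x → OddOrZero (count x 𝒢′)
    oddOrZero′ x = subst OddOrZero
      (sym (trans (count≡countᵇ x 𝒢′) (trans (same-count (x ∈ᵇ_)) (sym (count≡countᵇ x 𝒢)))))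
      (oddOrZero x)

_∈₀_ : ∀ {m} → Subset m → Family m → Set
X ∈₀ 𝒜 = X ∈ᴸ 𝒜 ⊎ X ≡ ⊥

module OddMultiset {m} {𝒜 : Family m} (u𝒜 : Unique 𝒜) (osf𝒜 : OddSunflowerFree 𝒜) (ac𝒜 : Antichain 𝒜)
  (ne𝒜 : All Nonempty 𝒜) (L : Family m) (L⊆𝒜₀ : All (_∈₀ 𝒜) L) (oddOrZero : ∀ y → OddOrZero (count y L)) where

  open Multiplicity (_≟ˢ_ {m})

  H : Family m
  H = filterᵇ (λ A → odd (mult A L)) 𝒜

  H⊑𝒜 : H ⊑ 𝒜
  H⊑𝒜 = filter-⊆ (T? ∘ λ A → odd (mult A L)) 𝒜

  countᵇ-L : ∀ y → countᵇ (y ∈ᵇ_) L ≡ sumOf (λ A → toℕ (y ∈ᵇ A) * mult A L) 𝒜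
  countᵇ-L y = countᵇ≡sumOf-mult (y ∈ᵇ_) u𝒜 L (All.map contains-y⇒∈𝒜 L⊆𝒜₀)
    where
    contains-y⇒∈𝒜 : ∀ {X} → X ∈₀ 𝒜 → y ∈ᵇ X ≡ true → X ∈ᴸ 𝒜
    contains-y⇒∈𝒜 (inj₁ X∈𝒜) _ = X∈𝒜
    contains-y⇒∈𝒜 (inj₂ refl) y∈⊥ with () ← trans (sym y∈⊥) (x∈ᵇ⊥ y)

  countᵇ-H : ∀ y → countᵇ (y ∈ᵇ_) H ≡ sumOf (λ A → toℕ (y ∈ᵇ A) * toℕ (odd (mult A L))) 𝒜
  countᵇ-H y = countᵇ-filter (y ∈ᵇ_) (T? ∘ λ A → odd (mult A L)) 𝒜

  odd-countᵇ-H : ∀ y → odd (countᵇ (y ∈ᵇ_) H) ≡ odd (countᵇ (y ∈ᵇ_) L)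
  odd-countᵇ-H y = begin
      odd (countᵇ (y ∈ᵇ_) H)                                     ≡⟨ cong odd (countᵇ-H y) ⟩
      odd (sumOf (λ A → toℕ (y ∈ᵇ A) * toℕ (odd (mult A L))) 𝒜)  ≡⟨ odd-sumOf-cong same-parity 𝒜 ⟩
      odd (sumOf (λ A → toℕ (y ∈ᵇ A) * mult A L) 𝒜)              ≡⟨ cong odd (countᵇ-L y) ⟨
      odd (countᵇ (y ∈ᵇ_) L)                                     ∎
    where
    open ≡-Reasoning
    same-parity : ∀ A → odd (toℕ (y ∈ᵇ A) * toℕ (odd (mult A L))) ≡ odd (toℕ (y ∈ᵇ A) * mult A L)
    same-parity A = begin
      odd (toℕ (y ∈ᵇ A) * toℕ (odd (mult A L)))  ≡⟨ odd-toℕ* (y ∈ᵇ A) _ ⟩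
      (y ∈ᵇ A) ∧ odd (toℕ (odd (mult A L)))      ≡⟨ cong ((y ∈ᵇ A) ∧_) (odd-toℕ _) ⟩
      (y ∈ᵇ A) ∧ odd (mult A L)                  ≡⟨ odd-toℕ* (y ∈ᵇ A) _ ⟨
      odd (toℕ (y ∈ᵇ A) * mult A L)              ∎

  countᵇ-H≡0 : ∀ y → countᵇ (y ∈ᵇ_) L ≡ 0 → countᵇ (y ∈ᵇ_) H ≡ 0
  countᵇ-H≡0 y L-misses-y = trans (countᵇ-H y) (sumOf-zero 𝒜 (λ {A} A∈ → vanishes A (term≡0 A∈)))
    where
    term≡0 : ∀ {A} → A ∈ᴸ 𝒜 → toℕ (y ∈ᵇ A) * mult A L ≡ 0
    term≡0 A∈ = n≤0⇒n≡0 (≤-trans (∈⇒≤sumOf _ A∈) (≤-reflexive (trans (sym (countᵇ-L y)) L-misses-y)))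
    vanishes : ∀ A → toℕ (y ∈ᵇ A) * mult A L ≡ 0 → toℕ (y ∈ᵇ A) * toℕ (odd (mult A L)) ≡ 0
    vanishes A e with m*n≡0⇒m≡0∨n≡0 (toℕ (y ∈ᵇ A)) {mult A L} e
    ... | inj₁ y∉A = cong (_* _) y∉A
    ... | inj₂ mult≡0 = trans (cong (λ k → toℕ (y ∈ᵇ A) * toℕ (odd k)) mult≡0) (*-zeroʳ (toℕ (y ∈ᵇ A)))

  odd⊎zero-L : ∀ y → odd (countᵇ (y ∈ᵇ_) L) ≡ true ⊎ countᵇ (y ∈ᵇ_) L ≡ 0
  odd⊎zero-L y = OddOrZero⇒odd⊎zero (subst OddOrZero (count≡countᵇ y L) (oddOrZero y))

  length-H≤1 : length H ≤ 1
  length-H≤1 with 2 ≤? length H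
  ... | no two≰ = ≤-pred (≰⇒> two≰)
  ... | yes two = ⊥-elim (osf𝒜 H H⊑𝒜 (two , All-resp-⊆ H⊑𝒜 ne𝒜 , oddOrZero-H))
    where
    oddOrZero-H : ∀ y → OddOrZero (count y H)
    oddOrZero-H y with odd⊎zero-L y
    ... | inj₁ odd-L = inj₁ (odd⇒%2≡1 (count y H) (trans (cong odd (count≡countᵇ y H)) (trans (odd-countᵇ-H y) odd-L)))
    ... | inj₂ L-misses-y = inj₂ (trans (count≡countᵇ y H) (countᵇ-H≡0 y L-misses-y))

  L-meets : ∀ {X y} → X ∈ᴸ L → y ∈ X → 1 ≤ countᵇ (y ∈ᵇ_) L
  L-meets {y = y} X∈L y∈X = subst (λ b → toℕ b ≤ countᵇ (y ∈ᵇ_) L) (∈⇒∈ᵇ y∈X) (∈⇒≤sumOf (λ A → toℕ (y ∈ᵇ A)) X∈L)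

  odd-countᵇ-H-at : ∀ {X y} → X ∈ᴸ L → y ∈ X → odd (countᵇ (y ∈ᵇ_) H) ≡ true
  odd-countᵇ-H-at {X} {y} X∈L y∈X with odd⊎zero-L y
  ... | inj₁ odd-L = trans (odd-countᵇ-H y) odd-L
  ... | inj₂ L-misses-y with () ← ≤-trans (L-meets X∈L y∈X) (≤-reflexive L-misses-y)

  H-singleton : ∀ {X} → X ∈ᴸ L → Nonempty X → Σ (Subset m) λ A₀ → H ≡ A₀ ∷ []
  H-singleton X∈L (y , y∈X) with H | length-H≤1 | odd-countᵇ-H-at X∈L y∈X
  ... | [] | _ | ()
  ... | A₀ ∷ [] | _ | _ = A₀ , refl
  ... | _ ∷ _ ∷ _ | s≤s () | _

  covering-member : ∀ {X} → X ∈ᴸ L → Nonempty X → Σ (Subset m) λ A₀ → A₀ ∈ᴸ 𝒜 × (∀ {Y} → Y ∈ᴸ L → Y ⊆ A₀)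
  covering-member X∈L X≠∅ with H-singleton X∈L X≠∅
  ... | A₀ , H≡[A₀] = A₀ , Sublist.lookup H⊑𝒜 (subst (A₀ ∈ᴸ_) (sym H≡[A₀]) (here refl)) , Y⊆A₀
    where
    Y⊆A₀ : ∀ {Y} → Y ∈ᴸ L → Y ⊆ A₀
    Y⊆A₀ Y∈L {z} z∈Y =
      ∈ᵇ⇒∈ (odd-singleton (subst (λ 𝒢 → odd (countᵇ (z ∈ᵇ_) 𝒢) ≡ true) H≡[A₀] (odd-countᵇ-H-at Y∈L z∈Y)))
      where
      odd-singleton : ∀ {b} → odd (toℕ b + 0) ≡ true → b ≡ true
      odd-singleton {true} _ = refl

  nonempty-members-≡ : ∀ {X Y} → X ∈ᴸ L → Y ∈ᴸ L → Nonempty X → Nonempty Y → X ≡ Y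
  nonempty-members-≡ X∈L Y∈L X≠∅ Y≠∅ with covering-member X∈L X≠∅
  ... | A₀ , A₀∈𝒜 , ⊆A₀ = trans (≡A₀ X∈L X≠∅) (sym (≡A₀ Y∈L Y≠∅))
    where
    ≡A₀ : ∀ {Z} → Z ∈ᴸ L → Nonempty Z → Z ≡ A₀
    ≡A₀ Z∈L Z≠∅ with All.lookup L⊆𝒜₀ Z∈L
    ... | inj₁ Z∈𝒜 = ⊆∧⊄⇒≡ (⊆A₀ Z∈L) (ac𝒜 Z∈𝒜 A₀∈𝒜)
    ... | inj₂ refl = ⊥-elim (¬Nonempty⊥ Z≠∅)

lookup-ext : ∀ {A : Set} {k} {u v : Vec A k} → (∀ i → lookup u i ≡ lookup v i) → u ≡ v
lookup-ext {u = u} {v} e = trans (sym (tabulate∘lookup u)) (trans (tabulate-cong e) (tabulate∘lookup v))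

length-cartesianProductWith : ∀ {A B C : Set} (f : A → B → C) xs ys →
  length (cartesianProductWith f xs ys) ≡ length xs * length ys
length-cartesianProductWith f [] ys = refl
length-cartesianProductWith f (x ∷ xs) ys =
  trans (length-++ (map (f x) ys)) (cong₂ _+_ (length-map (f x) ys) (length-cartesianProductWith f xs ys))

-- A subset of [n] × [m], encoded in Fin (n * m) through Fin.combine, is cut into n blocks of m points each.
module _ {n m : ℕ} where

  block : Fin n → Subset (n * m) → Subset m
  block i S = tabulate (λ y → combine i y ∈ᵇ S)

  ∈ᵇ-block : ∀ i y S → y ∈ᵇ block i S ≡ combine i y ∈ᵇ S
  ∈ᵇ-block i y S = lookup∘tabulate _ y

  block-concat : ∀ i (c : Vec (Subset m) n) → block i (concat c) ≡ lookup c i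
  block-concat i c = trans (tabulate-cong (lookup-concat c i)) (tabulate∘lookup (lookup c i))

  block-injective : ∀ {S S′} → (∀ i → block i S ≡ block i S′) → S ≡ S′
  block-injective {S} {S′} same-blocks = lookup-ext same-point
    where
    same-point : ∀ z → z ∈ᵇ S ≡ z ∈ᵇ S′
    same-point z with combine-surjective {n} {m} z
    ... | i , y , refl = begin
      combine i y ∈ᵇ S    ≡⟨ ∈ᵇ-block i y S ⟨
      y ∈ᵇ block i S      ≡⟨ cong (y ∈ᵇ_) (same-blocks i) ⟩
      y ∈ᵇ block i S′     ≡⟨ ∈ᵇ-block i y S′ ⟩
      combine i y ∈ᵇ S′   ∎
      where open ≡-Reasoning

  block-mono : ∀ {S S′} → S ⊆ S′ → ∀ i → block i S ⊆ block i S′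
  block-mono {S} {S′} S⊆S′ i {y} y∈ =
    ∈ᵇ⇒∈ (trans (∈ᵇ-block i y S′) (∈⇒∈ᵇ (S⊆S′ (∈ᵇ⇒∈ (trans (sym (∈ᵇ-block i y S)) (∈⇒∈ᵇ y∈))))))

  support : Subset (n * m) → Subset n
  support S = tabulate (λ i → does (nonempty? (block i S)))

  ∈ᵇ-support : ∀ i S → i ∈ᵇ support S ≡ does (nonempty? (block i S))
  ∈ᵇ-support i S = lookup∘tabulate _ i

  ∈-support⁺ : ∀ {i S} → Nonempty (block i S) → i ∈ support S
  ∈-support⁺ {i} {S} ne = ∈ᵇ⇒∈ (trans (∈ᵇ-support i S) (dec-true (nonempty? (block i S)) ne))

  ∈-support⁻ : ∀ {i S} → i ∈ support S → Nonempty (block i S)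
  ∈-support⁻ {i} {S} i∈ with nonempty? (block i S) in eq
  ... | yes ne = ne
  ... | no _ with () ← trans (sym (∈⇒∈ᵇ i∈)) (trans (∈ᵇ-support i S) (cong does eq))

  support-mono : ∀ {S S′} → S ⊆ S′ → support S ⊆ support S′
  support-mono {S} {S′} S⊆S′ {i} i∈ with ∈-support⁻ {S = S} i∈
  ... | y , y∈ = ∈-support⁺ {S = S′} (y , block-mono S⊆S′ i y∈)

choices : ∀ {m k} → Family m → Subset k → List (Vec (Subset m) k)
choices 𝒜 [] = [ [] ]
choices 𝒜 (false ∷ F) = map (⊥ ∷_) (choices 𝒜 F)
choices 𝒜 (true ∷ F) = cartesianProductWith _∷_ 𝒜 (choices 𝒜 F)

-- 𝓕 ⊗ 𝒜 = { ⋃_{i ∈ F} {i} × Aᵢ : F ∈ 𝓕, Aᵢ ∈ 𝒜 }, each member listed once per choice of the Aᵢ.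
_⊗_ : ∀ {n m} → Family n → Family m → Family (n * m)
𝓕 ⊗ 𝒜 = concatMap (λ F → map concat (choices 𝒜 F)) 𝓕

length-choices : ∀ {m k} (𝒜 : Family m) (F : Subset k) → length (choices 𝒜 F) ≡ length 𝒜 ^ ∣ F ∣
length-choices 𝒜 [] = refl
length-choices 𝒜 (false ∷ F) = trans (length-map (⊥ ∷_) (choices 𝒜 F)) (length-choices 𝒜 F)
length-choices 𝒜 (true ∷ F) =
  trans (length-cartesianProductWith _∷_ 𝒜 (choices 𝒜 F)) (cong (length 𝒜 *_) (length-choices 𝒜 F))

length-⊗ : ∀ {n m k} {𝓕 : Family n} (𝒜 : Family m) → Uniform k 𝓕 → length (𝓕 ⊗ 𝒜) ≡ length 𝓕 * length 𝒜 ^ k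
length-⊗ 𝒜 [] = refl
length-⊗ {𝓕 = F ∷ 𝓕} 𝒜 (∣F∣≡k ∷ uniform) = trans (length-++ (map concat (choices 𝒜 F)))
  (cong₂ _+_ (trans (length-map concat (choices 𝒜 F)) (trans (length-choices 𝒜 F) (cong (length 𝒜 ^_) ∣F∣≡k)))
             (length-⊗ 𝒜 uniform))

choices-unique : ∀ {m k} {𝒜 : Family m} → Unique 𝒜 → (F : Subset k) → Unique (choices 𝒜 F)
choices-unique u𝒜 [] = [] ∷ []
choices-unique u𝒜 (false ∷ F) = Unique.map⁺ ∷-injectiveʳ (choices-unique u𝒜 F)
choices-unique u𝒜 (true ∷ F) = Unique.cartesianProductWith⁺ _∷_ ∷-injective u𝒜 (choices-unique u𝒜 F)

Fits : ∀ {m} → Family m → Bool → Subset m → Set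
Fits 𝒜 true B = B ∈ᴸ 𝒜
Fits 𝒜 false B = B ≡ ⊥

∈-choices⁻ : ∀ {m k} (𝒜 : Family m) (F : Subset k) {c} → c ∈ᴸ choices 𝒜 F → ∀ i → Fits 𝒜 (lookup F i) (lookup c i)
∈-choices⁻ 𝒜 (false ∷ F) c∈ i with ∈-map⁻ (⊥ ∷_) c∈
... | c′ , c′∈ , refl with i
...   | zero = refl
...   | suc i = ∈-choices⁻ 𝒜 F c′∈ i
∈-choices⁻ 𝒜 (true ∷ F) c∈ i with ∈-cartesianProductWith⁻ _∷_ 𝒜 (choices 𝒜 F) c∈
... | A , c′ , A∈ , c′∈ , refl with i
...   | zero = A∈
...   | suc i = ∈-choices⁻ 𝒜 F c′∈ i

module _ {n m : ℕ} {𝒜 : Family m} (ne𝒜 : All Nonempty 𝒜) where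

  Fits⇒∈₀ : ∀ {b B} → Fits 𝒜 b B → B ∈₀ 𝒜
  Fits⇒∈₀ {true} B∈ = inj₁ B∈
  Fits⇒∈₀ {false} B≡⊥ = inj₂ B≡⊥

  Fits⇒nonempty≡ : ∀ {b B} → Fits 𝒜 b B → does (nonempty? B) ≡ b
  Fits⇒nonempty≡ {true} {B} B∈ = dec-true (nonempty? B) (All.lookup ne𝒜 B∈)
  Fits⇒nonempty≡ {false} refl = dec-false (nonempty? (⊥ {m})) ¬Nonempty⊥

  ∈-generated⁻ : ∀ {F : Subset n} {S} → S ∈ᴸ map concat (choices 𝒜 F) → support S ≡ F × (∀ i → block i S ∈₀ 𝒜)
  ∈-generated⁻ {F} S∈ with ∈-map⁻ concat S∈
  ... | c , c∈ , refl =
    lookup-ext support≡F , λ i → subst (_∈₀ 𝒜) (sym (block-concat i c)) (Fits⇒∈₀ (∈-choices⁻ 𝒜 F c∈ i))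
    where
    support≡F : ∀ i → i ∈ᵇ support (concat c) ≡ i ∈ᵇ F
    support≡F i = trans (∈ᵇ-support i (concat c))
      (trans (cong (does ∘ nonempty?) (block-concat i c)) (Fits⇒nonempty≡ (∈-choices⁻ 𝒜 F c∈ i)))

  ∈-⊗⁻ : ∀ {𝓕 : Family n} {S} → S ∈ᴸ 𝓕 ⊗ 𝒜 → support S ∈ᴸ 𝓕 × (∀ i → block i S ∈₀ 𝒜)
  ∈-⊗⁻ {𝓕} S∈ with find (∈-concatMap⁻ (λ F → map concat (choices 𝒜 F)) {xs = 𝓕} S∈)
  ... | F , F∈ , S∈gen with ∈-generated⁻ {F} S∈gen
  ...   | support≡F , blocks∈₀ = subst (_∈ᴸ 𝓕) (sym support≡F) F∈ , blocks∈₀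

  concat-injective : ∀ {c c′ : Vec (Subset m) n} → concat c ≡ concat c′ → c ≡ c′
  concat-injective {c} {c′} e =
    lookup-ext (λ i → trans (sym (block-concat i c)) (trans (cong (block i) e) (block-concat i c′)))

  ⊗-unique : ∀ {𝓕 : Family n} → Unique 𝓕 → Unique 𝒜 → Unique (𝓕 ⊗ 𝒜)
  ⊗-unique {𝓕} u𝓕 u𝒜 = Unique.concat⁺
    (All.map⁺ (All.universal (λ F → Unique.map⁺ concat-injective (choices-unique u𝒜 F)) 𝓕))
    (AllPairs.map⁺ (AllPairs.map (λ {F} {F′} F≢F′ {_} (S∈ , S∈′) →
      F≢F′ (trans (sym (proj₁ (∈-generated⁻ {F} S∈))) (proj₁ (∈-generated⁻ {F′} S∈′)))) u𝓕))

  ∈₀-⊆⇒≡ : Antichain 𝒜 → ∀ {X Y} → X ∈₀ 𝒜 → Y ∈₀ 𝒜 → X ⊆ Y → (Nonempty Y → Nonempty X) → X ≡ Y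
  ∈₀-⊆⇒≡ ac𝒜 (inj₁ X∈) (inj₁ Y∈) X⊆Y _ = ⊆∧⊄⇒≡ X⊆Y (ac𝒜 X∈ Y∈)
  ∈₀-⊆⇒≡ ac𝒜 (inj₁ X∈) (inj₂ refl) X⊆⊥ _ with All.lookup ne𝒜 X∈
  ... | x , x∈X = ⊥-elim (∉⊥ (X⊆⊥ x∈X))
  ∈₀-⊆⇒≡ ac𝒜 (inj₂ refl) (inj₁ Y∈) _ nonempty = ⊥-elim (¬Nonempty⊥ (nonempty (All.lookup ne𝒜 Y∈)))
  ∈₀-⊆⇒≡ ac𝒜 (inj₂ refl) (inj₂ refl) _ _ = refl

  ⊗-antichain : ∀ {𝓕 : Family n} → Antichain 𝓕 → Antichain 𝒜 → Antichain (𝓕 ⊗ 𝒜)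
  ⊗-antichain {𝓕} ac𝓕 ac𝒜 {S} {S′} S∈ S′∈ (S⊆S′ , z , z∈S′ , z∉S) = z∉S (subst (z ∈_) (sym S≡S′) z∈S′)
    where
    support≡ : support S ≡ support S′
    support≡ = ⊆∧⊄⇒≡ (support-mono S⊆S′) (ac𝓕 (proj₁ (∈-⊗⁻ {𝓕} S∈)) (proj₁ (∈-⊗⁻ {𝓕} S′∈)))
    S≡S′ : S ≡ S′
    S≡S′ = block-injective λ i → ∈₀-⊆⇒≡ ac𝒜 (proj₂ (∈-⊗⁻ {𝓕} S∈) i) (proj₂ (∈-⊗⁻ {𝓕} S′∈) i) (block-mono S⊆S′ i)
      (∈-support⁻ {S = S} ∘ subst (i ∈_) (sym support≡) ∘ ∈-support⁺ {S = S′})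

  module SupportsOfOddFamily {𝓕 : Family n} (u𝓕 : Unique 𝓕) (u𝒜 : Unique 𝒜) (osf𝒜 : OddSunflowerFree 𝒜)
    (ac𝒜 : Antichain 𝒜) (G : Family (n * m)) (G⊑ : G ⊑ 𝓕 ⊗ 𝒜) (oddOrZero : ∀ z → OddOrZero (count z G)) where

    supports : Family n
    supports = map support G

    ∈⊗ : ∀ {S} → S ∈ᴸ G → S ∈ᴸ 𝓕 ⊗ 𝒜
    ∈⊗ = Sublist.lookup G⊑

    count-blocks : ∀ (i : Fin n) y → count y (map (block i) G) ≡ count (combine i y) G
    count-blocks i y = begin
      count y (map (block i) G)                 ≡⟨ count≡countᵇ y (map (block i) G) ⟩
      countᵇ (y ∈ᵇ_) (map (block i) G)          ≡⟨ countᵇ-map (y ∈ᵇ_) (block i) G ⟩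
      countᵇ (λ S → y ∈ᵇ block i S) G           ≡⟨ sumOf-cong G (λ {S} _ → cong toℕ (∈ᵇ-block i y S)) ⟩
      countᵇ (λ S → combine i y ∈ᵇ S) G         ≡⟨ count≡countᵇ (combine i y) G ⟨
      count (combine i y) G                     ∎
      where open ≡-Reasoning

    aligned : ∀ (i : Fin n) {S S′} → S ∈ᴸ G → S′ ∈ᴸ G →
      Nonempty (block i S) → Nonempty (block i S′) → block i S ≡ block i S′
    aligned i S∈ S′∈ = OddMultiset.nonempty-members-≡ u𝒜 osf𝒜 ac𝒜 ne𝒜 (map (block i) G)
      (All.map⁺ (All.tabulate (λ S∈ → proj₂ (∈-⊗⁻ {𝓕} (∈⊗ S∈)) i)))
      (λ y → subst OddOrZero (sym (count-blocks i y)) (oddOrZero (combine i y)))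
      (∈-map⁺ (block i) S∈) (∈-map⁺ (block i) S′∈)

    support-injective : ∀ {S S′} → S ∈ᴸ G → S′ ∈ᴸ G → support S ≡ support S′ → S ≡ S′
    support-injective {S} {S′} S∈ S′∈ support≡ = block-injective same-block
      where
      same-block : ∀ i → block i S ≡ block i S′
      same-block i with nonempty? (block i S) | nonempty? (block i S′)
      ... | yes ne | yes ne′ = aligned i S∈ S′∈ ne ne′
      ... | no ¬ne | no ¬ne′ = trans (Empty-unique ¬ne) (sym (Empty-unique ¬ne′))
      ... | yes ne | no ¬ne′ = ⊥-elim (¬ne′ (∈-support⁻ {S = S′} (subst (i ∈_) support≡ (∈-support⁺ {S = S} ne))))
      ... | no ¬ne | yes ne′ = ⊥-elim (¬ne (∈-support⁻ {S = S} (subst (i ∈_) (sym support≡) (∈-support⁺ {S = S′} ne′))))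

    supports-unique : Unique supports
    supports-unique = map⁺-injectiveOn support-injective (Unique-resp-⊑ G⊑ (⊗-unique u𝓕 u𝒜))

    supports⊆𝓕 : All (_∈ᴸ 𝓕) supports
    supports⊆𝓕 = All.map⁺ (All.tabulate (λ S∈ → proj₁ (∈-⊗⁻ {𝓕} (∈⊗ S∈))))

    length-supports : length supports ≡ length G
    length-supports = length-map (support {n} {m}) G

    supports-nonempty : All Nonempty G → All Nonempty supports
    supports-nonempty neG = All.map⁺ (All.map nonempty-support neG)
      where
      nonempty-support : ∀ {S} → Nonempty S → Nonempty (support S)
      nonempty-support {S} (z , z∈S) with combine-surjective {n} {m} z
      ... | i , y , refl = i , ∈-support⁺ {S = S} (y , ∈ᵇ⇒∈ (trans (∈ᵇ-block i y S) (∈⇒∈ᵇ z∈S)))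

    count-supports : ∀ i → count i supports ≡ countᵇ (λ S → does (nonempty? (block i S))) G
    count-supports i = trans (count≡countᵇ i supports)
      (trans (countᵇ-map (i ∈ᵇ_) support G) (sumOf-cong G (λ {S} _ → cong toℕ (∈ᵇ-support i S))))

    -- A point y of a nonempty i-block lies in exactly those S ∈ G whose i-block is nonempty.
    count-via-witness : ∀ {i y S₀} → S₀ ∈ᴸ G → y ∈ block i S₀ → count i supports ≡ count (combine i y) G
    count-via-witness {i} {y} {S₀} S₀∈ y∈ = trans (count-supports i)
      (trans (sumOf-cong G (λ {S} S∈ → cong toℕ (nonempty≡∈ S∈ (nonempty? (block i S)))))
             (sym (count≡countᵇ (combine i y) G)))
      where
      nonempty≡∈ : ∀ {S} → S ∈ᴸ G → (ne? : Dec (Nonempty (block i S))) → does ne? ≡ combine i y ∈ᵇ S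
      nonempty≡∈ {S} S∈ (yes ne) = sym (trans (sym (∈ᵇ-block i y S))
        (trans (cong (y ∈ᵇ_) (aligned i S∈ S₀∈ ne (y , y∈))) (∈⇒∈ᵇ y∈)))
      nonempty≡∈ {S} S∈ (no ¬ne) = sym (trans (sym (∈ᵇ-block i y S))
        (trans (cong (y ∈ᵇ_) (Empty-unique ¬ne)) (x∈ᵇ⊥ y)))

    supports-oddOrZero : ∀ i → OddOrZero (count i supports)
    supports-oddOrZero i with any? (λ S → nonempty? (block i S)) G
    ... | yes some with find some
    ...   | S₀ , S₀∈ , y , y∈ = subst OddOrZero (sym (count-via-witness S₀∈ y∈)) (oddOrZero (combine i y))
    supports-oddOrZero i | no none = inj₂ (trans (count-supports i)
      (sumOf-zero G (λ {S} S∈ → cong toℕ (dec-false (nonempty? (block i S)) (none ∘ lose S∈)))))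

  ⊗-oddSunflowerFree : ∀ {𝓕 : Family n} → Unique 𝓕 → OddSunflowerFree 𝓕 →
    Unique 𝒜 → OddSunflowerFree 𝒜 → Antichain 𝒜 → OddSunflowerFree (𝓕 ⊗ 𝒜)
  ⊗-oddSunflowerFree u𝓕 osf𝓕 u𝒜 osf𝒜 ac𝒜 G G⊑ (two , neG , oddOrZero) =
    subfamily-¬OddSunflower u𝓕 osf𝓕 supports-unique supports⊆𝓕
      (≤-trans two (≤-reflexive (sym length-supports)) , supports-nonempty neG , supports-oddOrZero)
    where open SupportsOfOddFamily u𝓕 u𝒜 osf𝒜 ac𝒜 G G⊑ oddOrZero

⊗-OSFAntichain : ∀ {n m} {𝓕 : Family n} {𝒜 : Family m} → OSFAntichain 𝓕 → OSFAntichain 𝒜 → All Nonempty 𝒜 →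
  OSFAntichain (𝓕 ⊗ 𝒜)
⊗-OSFAntichain (u𝓕 , osf𝓕 , ac𝓕) (u𝒜 , osf𝒜 , ac𝒜) ne𝒜 =
  ⊗-unique ne𝒜 u𝓕 u𝒜 , ⊗-oddSunflowerFree ne𝒜 u𝓕 osf𝓕 u𝒜 osf𝒜 ac𝒜 , ⊗-antichain ne𝒜 ac𝓕 ac𝒜

singleton-OSFAntichain : ∀ {m} (X : Subset m) → OSFAntichain (X ∷ [])
singleton-OSFAntichain X = ([] ∷ []) , too-small , (λ { (here refl) (here refl) (_ , _ , x∈X , x∉X) → x∉X x∈X })
  where
  too-small : OddSunflowerFree (X ∷ [])
  too-small 𝒢 𝒢⊑ (two , _) with ≤-trans two (Sublist.length-mono-≤ 𝒢⊑)
  ... | s≤s ()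

-- If an extremal family contains ∅, the antichain condition forces it to be {∅}; then f_oa(m) = 1 is also
-- attained by a singleton {x}, which needs m ≥ 1.
extremal-nonempty : ∀ {m a} → 1 ≤ m → IsFoa m a → Σ (Family m) λ 𝒜 → OSFAntichain 𝒜 × All Nonempty 𝒜 × length 𝒜 ≡ a
extremal-nonempty {suc _} {a} _ ((𝒜 , osa@(u𝒜 , _ , ac𝒜) , length≡a) , maximal) with All.all? nonempty? 𝒜
... | yes ne𝒜 = 𝒜 , osa , ne𝒜 , length≡a
... | no ¬ne𝒜 with find (All.¬All⇒Any¬ nonempty? 𝒜 ¬ne𝒜)
...   | X , X∈ , X-empty = ⁅ zero ⁆ ∷ [] , singleton-OSFAntichain _ , (zero , x∈⁅x⁆ zero) ∷ [] , 1≡a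
  where
  all-empty : All (_∈ᴸ ⊥ ∷ []) 𝒜
  all-empty = All.tabulate λ {Y} Y∈ → here (Empty-unique λ (y , y∈Y) →
    ac𝒜 X∈ Y∈ (subst (_⊆ Y) (sym (Empty-unique X-empty)) ⊥⊆ , y , y∈Y , subst (y ∉_) (sym (Empty-unique X-empty)) ∉⊥))
  1≡a : 1 ≡ a
  1≡a = ≤-antisym (maximal _ (singleton-OSFAntichain ⁅ zero ⁆))
    (≤-trans (≤-reflexive (sym length≡a)) (Multiplicity.unique-⊆⇒length-≤ _≟ˢ_ ([] ∷ []) u𝒜 all-empty))

module _ {n : ℕ} where

  coSingleton : Fin n → Subset n
  coSingleton i = ∁ ⁅ i ⁆

  ∈-coSingleton : ∀ {x i} → x ≢ i → x ∈ coSingleton i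
  ∈-coSingleton x≢i = x∉p⇒x∈∁p (x≢y⇒x∉⁅y⁆ x≢i)

  ∉-coSingleton : ∀ i → i ∉ coSingleton i
  ∉-coSingleton i i∈ = x∈∁p⇒x∉p i∈ (x∈⁅x⁆ i)

  coSingleton-injective : ∀ {i j} → coSingleton i ≡ coSingleton j → i ≡ j
  coSingleton-injective {i} {j} e with i Fin.≟ j
  ... | yes i≡j = i≡j
  ... | no i≢j = ⊥-elim (∉-coSingleton i (subst (i ∈_) (sym e) (∈-coSingleton i≢j)))

coSingletons : ∀ n → Family n
coSingletons n = map coSingleton (allFin n)

module _ {n : ℕ} where

  length-coSingletons : length (coSingletons n) ≡ n
  length-coSingletons = trans (length-map coSingleton (allFin n)) (length-tabulate (λ i → i))

  coSingletons-unique : Unique (coSingletons n)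
  coSingletons-unique = Unique.map⁺ coSingleton-injective (Unique.allFin⁺ n)

  coSingletons-uniform : Uniform (n ∸ 1) (coSingletons n)
  coSingletons-uniform = All.map⁺ (All.universal (λ i → trans (∣∁p∣≡n∸∣p∣ ⁅ i ⁆) (cong (n ∸_) (∣⁅x⁆∣≡1 i))) (allFin n))

  coSingletons-antichain : Antichain (coSingletons n)
  coSingletons-antichain A∈ B∈ with ∈-map⁻ coSingleton A∈ | ∈-map⁻ coSingleton B∈
  ... | i , _ , refl | j , _ , refl = not-proper
    where
    not-proper : ¬ (coSingleton i ⊂ coSingleton j)
    not-proper (A⊆B , x , x∈B , x∉A) with i Fin.≟ j
    ... | yes refl = x∉A x∈B
    ... | no i≢j = ∉-coSingleton j (A⊆B (∈-coSingleton (i≢j ∘ sym)))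

  -- A point x lies in every co-singleton except {x}ᶜ; so if {i}ᶜ ∈ G then |G| = count i G + 1 is even,
  -- while a point x with {x}ᶜ ∉ G has count x G = |G| ≥ 2, which must be odd. Hence G = all n co-singletons,
  -- contradicting the parity of n.
  module OddFamilyOfCoSingletons (n-odd : n % 2 ≡ 1) (G : Family n) (G⊑ : G ⊑ coSingletons n) (two : 2 ≤ length G)
    (oddOrZero : ∀ x → OddOrZero (count x G)) {i} (i∈G : coSingleton i ∈ᴸ G) where

    open Multiplicity (_≟ˢ_ {n})

    count+mult≡length : ∀ x → count x G + mult (coSingleton x) G ≡ length G
    count+mult≡length x = begin
        count x G + mult (coSingleton x) G
      ≡⟨ cong (_+ mult (coSingleton x) G) (count≡countᵇ x G) ⟩
        countᵇ (x ∈ᵇ_) G + mult (coSingleton x) G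
      ≡⟨ sumOf-+ (λ S → toℕ (x ∈ᵇ S)) (λ S → toℕ (does (coSingleton x ≟ˢ S))) G ⟨
        sumOf (λ S → toℕ (x ∈ᵇ S) + toℕ (does (coSingleton x ≟ˢ S))) G
      ≡⟨ sumOf-cong G (one-each ∘ Sublist.lookup G⊑) ⟩
        countᵇ (λ _ → true) G
      ≡⟨ length≡countᵇ G ⟨
        length G
      ∎
      where
      open ≡-Reasoning
      one-each : ∀ {S} → S ∈ᴸ coSingletons n → toℕ (x ∈ᵇ S) + toℕ (does (coSingleton x ≟ˢ S)) ≡ 1
      one-each S∈ with ∈-map⁻ coSingleton S∈
      ... | j , _ , refl with x Fin.≟ j
      ...   | yes refl = cong₂ (λ b c → toℕ b + toℕ c) (∉⇒∈ᵇ (∉-coSingleton x))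
                           (dec-true (coSingleton x ≟ˢ coSingleton x) refl)
      ...   | no x≢j = cong₂ (λ b c → toℕ b + toℕ c) (∈⇒∈ᵇ (∈-coSingleton x≢j))
                         (dec-false (coSingleton x ≟ˢ coSingleton j) (x≢j ∘ coSingleton-injective))

    count+membership≡length : ∀ x {b} → does (coSingleton x ∈ᴸ? G) ≡ b → count x G + toℕ b ≡ length G
    count+membership≡length x {b} e =
      trans (cong (count x G +_) (sym (trans (mult-unique (coSingleton x) uG) (cong toℕ e)))) (count+mult≡length x)
      where
      uG : Unique G
      uG = Unique-resp-⊑ G⊑ coSingletons-unique

    odd-if-positive : ∀ x → 1 ≤ count x G → odd (count x G) ≡ true
    odd-if-positive x pos with oddOrZero x
    ... | inj₁ x-odd = %2≡1⇒odd (count x G) x-odd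
    ... | inj₂ x-zero with () ← ≤-trans pos (≤-reflexive x-zero)

    length-even : odd (length G) ≡ false
    length-even = begin
      odd (length G)                  ≡⟨ cong odd (count+membership≡length i (dec-true (_ ∈ᴸ? G) i∈G)) ⟨
      odd (count i G + 1)             ≡⟨ odd-+ (count i G) 1 ⟩
      odd (count i G) xor true        ≡⟨ cong (_xor true) (odd-if-positive i i-covered) ⟩
      false                           ∎
      where
      open ≡-Reasoning
      i-covered : 1 ≤ count i G
      i-covered = ≤-pred (≤-trans two (≤-reflexive
        (trans (sym (count+membership≡length i (dec-true (_ ∈ᴸ? G) i∈G))) (+-comm (count i G) 1))))

    false≢true : false ≢ true
    false≢true ()

    all-covered⇒⊥ : (∀ x → coSingleton x ∈ᴸ G) → Data.Empty.⊥
    all-covered⇒⊥ all∈ = false≢true (trans (sym length-even) (trans (cong odd length≡n) (%2≡1⇒odd n n-odd)))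
      where
      length≡n : length G ≡ n
      length≡n = trans (≤-antisym (Sublist.length-mono-≤ G⊑)
        (unique-⊆⇒length-≤ (Unique-resp-⊑ G⊑ coSingletons-unique) coSingletons-unique
          (All.map⁺ (All.universal all∈ (allFin n))))) length-coSingletons

    uncovered⇒⊥ : ∀ x → ¬ coSingleton x ∈ᴸ G → Data.Empty.⊥
    uncovered⇒⊥ x x-uncovered =
      false≢true (sym (trans (sym (odd-if-positive x x-covered)) (trans (cong odd count≡length) length-even)))
      where
      count≡length : count x G ≡ length G
      count≡length = trans (sym (+-identityʳ _)) (count+membership≡length x (dec-false (_ ∈ᴸ? G) x-uncovered))
      x-covered : 1 ≤ count x G
      x-covered = ≤-trans (≤-trans (s≤s z≤n) two) (≤-reflexive (sym count≡length))

    impossible : Data.Empty.⊥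
    impossible with all? (λ x → coSingleton x ∈ᴸ? G)
    ... | yes all∈ = all-covered⇒⊥ all∈
    ... | no ¬all∈ with ¬∀⟶∃¬ n _ (λ x → coSingleton x ∈ᴸ? G) ¬all∈
    ...   | x , x-uncovered = uncovered⇒⊥ x x-uncovered

  coSingletons-oddSunflowerFree : n % 2 ≡ 1 → OddSunflowerFree (coSingletons n)
  coSingletons-oddSunflowerFree n-odd [] _ (() , _)
  coSingletons-oddSunflowerFree n-odd G@(_ ∷ _) G⊑ (two , _ , oddOrZero)
    with ∈-map⁻ coSingleton (Sublist.lookup G⊑ (here refl))
  ... | i , _ , refl = OddFamilyOfCoSingletons.impossible n-odd G G⊑ two oddOrZero (here refl)

foa-product-bound : (n k : ℕ) (𝓕 : Family n) → OSFAntichain 𝓕 → Uniform k 𝓕 →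
  (m : ℕ) → 1 ≤ m → (a b : ℕ) → IsFoa m a → IsFoa (n * m) b → length 𝓕 * a ^ k ≤ b
foa-product-bound n k 𝓕 osa𝓕 uniform m 1≤m a b foa-a (_ , maximal)
  with extremal-nonempty 1≤m foa-a
... | 𝒜 , osa𝒜 , ne𝒜 , length≡a = begin
  length 𝓕 * a ^ k            ≡⟨ cong (λ t → length 𝓕 * t ^ k) length≡a ⟨
  length 𝓕 * length 𝒜 ^ k     ≡⟨ length-⊗ 𝒜 uniform ⟨
  length (𝓕 ⊗ 𝒜)              ≤⟨ maximal (𝓕 ⊗ 𝒜) (⊗-OSFAntichain osa𝓕 osa𝒜 ne𝒜) ⟩
  b                           ∎
  where open ≤-Reasoning

foa-coSingletons-bound : (n : ℕ) → n % 2 ≡ 1 → (m : ℕ) → 1 ≤ m → (a b : ℕ) →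
  IsFoa m a → IsFoa (n * m) b → n * a ^ (n ∸ 1) ≤ b
foa-coSingletons-bound n n-odd m 1≤m a b foa-a foa-b =
  subst (λ t → t * a ^ (n ∸ 1) ≤ b) (length-coSingletons {n})
    (foa-product-bound n (n ∸ 1) (coSingletons n)
      (coSingletons-unique , coSingletons-oddSunflowerFree n-odd , coSingletons-antichain)
      coSingletons-uniform m 1≤m a b foa-a foa-b)

corollary7 :
    ((n k : ℕ) (𝓕 : Family n) → OSFAntichain 𝓕 → Uniform k 𝓕 →
      (m : ℕ) → 1 ≤ m → (a b : ℕ) → IsFoa m a → IsFoa (n * m) b →
      length 𝓕 * a ^ k ≤ b)
    ×
    ((n : ℕ) → n % 2 ≡ 1 → (m : ℕ) → 1 ≤ m → (a b : ℕ) →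
      IsFoa m a → IsFoa (n * m) b → n * a ^ (n ∸ 1) ≤ b)
corollary7 = foa-product-bound , foa-coSingletons-bound
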